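{- For every finite connected graph $G$, $\mathsf{DL}(G) \leq r(G)$.
   Context: For a finite connected graph $G=(V,E)$ with $|V|=n$ and graph distance $d$, a $k$-dispersed labelling is a bijection $\phi:\{1,\dots,n\}\to V$ with $d(\phi(i),\phi(i+1))\ge k$ for $1\le i\le n-1$. $\mathsf{DL}(G)$ is the maximum $k$ such that $G$ has a $k$-dispersed labelling. The eccentricity of $v$ is $\epsilon(v)=\max_{u\in V} d(v,u)$ and the radius is $r(G)=\min_{v\in V}\epsilon(v)$. -}

module Defs where

open import Level using (0ℓ)
open import Data.Nat using (ℕ; zero; suc; _≤_)
open import Data.Fin using (Fin; toℕ)
open import Data.Product using (Σ; ∃; _×_)
open import Relation.Nullary using (¬_)
open import Relation.Binary.PropositionalEquality using (_≡_)
open import Function.Bundles using (_⤖_; Bijection)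

record Graph (n : ℕ) : Set₁ where
  field
    Adj     : Fin n → Fin n → Set
    sym     : ∀ {u v} → Adj u v → Adj v u
    irrefl  : ∀ {u} → ¬ Adj u u

module _ {n : ℕ} (G : Graph n) where
  open Graph G

  data Walk : Fin n → Fin n → ℕ → Set where
    here : ∀ {u} → Walk u u zero
    step : ∀ {u w v ℓ} → Adj u w → Walk w v ℓ → Walk u v (suc ℓ)

  Connected : Set
  Connected = ∀ u v → ∃ λ ℓ → Walk u v ℓ

  Dist : Fin n → Fin n → ℕ → Set
  Dist u v m = Walk u v m × (∀ ℓ → Walk u v ℓ → m ≤ ℓ)

  Ecc : Fin n → ℕ → Set
  Ecc v e = (∃ λ u → Dist v u e) × (∀ u m → Dist v u m → m ≤ e)

  Radius : ℕ → Set
  Radius r = (∃ λ v → Ecc v r) × (∀ v e → Ecc v e → r ≤ e)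

  -- k-dispersed labelling: a bijection φ from labels (Fin n, label i ↔ i+1)
  -- to vertices with d(φ(i), φ(i+1)) ≥ k for consecutive labels.
  IsDispersed : ℕ → Fin n ⤖ Fin n → Set
  IsDispersed k φ = ∀ (i j : Fin n) → toℕ j ≡ suc (toℕ i) →
    ∀ m → Dist (Bijection.to φ i) (Bijection.to φ j) m → k ≤ m

  HasDispersedLabelling : ℕ → Set
  HasDispersedLabelling k = ∃ λ φ → IsDispersed k φ

  IsDL : ℕ → Set
  IsDL d = HasDispersedLabelling d × (∀ k → HasDispersedLabelling k → k ≤ d)

-- Let v be a centre of G, so every vertex lies within distance r(G) of v. With at least two
-- labels, the label of v has a consecutive label, whose vertex u is at distance ≥ DL(G) from v
-- by dispersion; hence DL(G) ≤ d(v, u) ≤ ε(v) = r(G). Shortest walks only exist under double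
-- negation here, which suffices because ≤ on ℕ is decidable.
module Submission where

open import Defs
open import Data.Nat using (ℕ; suc; _≤_; _<_; _≤?_; z≤n; s≤s)
open import Data.Nat.Properties using (≤-trans; ≰⇒>)
open import Data.Nat.Induction using (<-rec)
open import Data.Fin using (Fin; toℕ; inject₁) renaming (zero to fzero; suc to fsuc)
open import Data.Fin.Properties using (toℕ-inject₁)
open import Data.Product using (∃; _×_; _,_)
open import Data.Sum using (_⊎_; inj₁; inj₂)
open import Data.Empty using (⊥-elim)
open import Relation.Nullary using (¬_; yes; no)
open import Relation.Nullary.Decidable.Core using (decidable-stable)
open import Relation.Binary.PropositionalEquality using (_≡_; refl; sym; cong)
open import Function.Bundles using (_⤖_; Bijection)

¬¬-least : (P : ℕ → Set) → ∀ ℓ → P ℓ → ¬ ¬ ∃ λ m → P m × (∀ k → P k → m ≤ k)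
¬¬-least P ℓ pℓ no-least = <-rec (λ l → ¬ P l) no-smaller-than ℓ pℓ
  where
  no-smaller-than : ∀ l → (∀ {l′} → l′ < l → ¬ P l′) → ¬ P l
  no-smaller-than l ih pl = no-least (l , pl , l-least)
    where
    l-least : ∀ k → P k → l ≤ k
    l-least k pk with l ≤? k
    ... | yes l≤k = l≤k
    ... | no  l≰k = ⊥-elim (ih (≰⇒> l≰k) pk)

consecutive-label : ∀ {n} → 2 ≤ n → (i : Fin n) →
                    ∃ λ (j : Fin n) → toℕ j ≡ suc (toℕ i) ⊎ toℕ i ≡ suc (toℕ j)
consecutive-label (s≤s (s≤s z≤n)) fzero    = fsuc fzero , inj₁ refl
consecutive-label (s≤s (s≤s z≤n)) (fsuc i) = inject₁ i , inj₂ (cong suc (sym (toℕ-inject₁ i)))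

module _ {n : ℕ} (G : Graph n) where
  open Graph G using (Adj) renaming (sym to Adj-sym)

  Walk-snoc : ∀ {u w v ℓ} → Walk G u w ℓ → Adj w v → Walk G u v (suc ℓ)
  Walk-snoc here         a = step a here
  Walk-snoc (step a′ p) a = step a′ (Walk-snoc p a)

  Walk-reverse : ∀ {u v ℓ} → Walk G u v ℓ → Walk G v u ℓ
  Walk-reverse here       = here
  Walk-reverse (step a p) = Walk-snoc (Walk-reverse p) (Adj-sym a)

  Dist-sym : ∀ {u v m} → Dist G u v m → Dist G v u m
  Dist-sym (p , shortest) = Walk-reverse p , λ ℓ q → shortest ℓ (Walk-reverse q)

  ¬¬-Dist : Connected G → ∀ u v → ¬ ¬ ∃ (Dist G u v)
  ¬¬-Dist conn u v = let (ℓ , p) = conn u v in ¬¬-least (Walk G u v) ℓ p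

  dispersed⇒far-vertex : ∀ {k} {φ : Fin n ⤖ Fin n} → IsDispersed G k φ → 2 ≤ n →
                         ∀ v → ∃ λ u → ∀ m → Dist G v u m → k ≤ m
  dispersed⇒far-vertex {φ = φ} dispersed 2≤n v
    with Bijection.strictlySurjective φ v
  ... | i , refl with consecutive-label 2≤n i
  ...   | j , inj₁ j≡1+i = Bijection.to φ j , dispersed i j j≡1+i
  ...   | j , inj₂ i≡1+j = Bijection.to φ j , λ m d → dispersed j i i≡1+j m (Dist-sym d)

theorem2p2 : ∀ {n : ℕ} (G : Graph n) → 2 ≤ n → Connected G →
    ∀ d r → IsDL G d → Radius G r → d ≤ r
theorem2p2 G 2≤n conn d r ((φ , dispersed) , _) ((v , _ , within-r) , _) =
  decidable-stable (d ≤? r) λ d≰r →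
    let (u , far) = dispersed⇒far-vertex G {φ = φ} dispersed 2≤n v in
    ¬¬-Dist G conn v u λ (m , dist) →
      d≰r (≤-trans (far m dist) (within-r u m dist))
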